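{- Let $n$ be a positive integer. Then $\mathrm{sh}_{CG}^2(n) = \mathrm{sh}_F^2(n)$ if and only if $n \in F_{even}$. More precisely, $$\mathrm{sh}_{CG}^2(n) = \begin{cases} \mathrm{sh}_F^2(n) & \text{if } n \in F_{even},\\ \mathrm{sh}_F^2(n) + 1 & \text{if } n \in F_{odd}.\end{cases}$$
   Context: Fibonacci numbers: $F_0=0$, $F_1=1$, $F_{m+1}=F_m+F_{m-1}$. Zeckendorf representation: every positive integer $n$ is uniquely a sum $n=\sum_{i\in S}F_i$ of Fibonacci numbers with indices $i\ge 2$, no two indices consecutive. The Zeckendorf shift is $\mathrm{sh}_F(n)=\sum_{i\in S}F_{i+1}$ (and $\mathrm{sh}_F(0)=0$); so $\mathrm{sh}_F^2(n)=\sum_{i\in S}F_{i+2}$. Chung–Graham representation: every nonnegative integer $n$ is uniquely $n=\sum_{j\ge1}c_jF_{2j}$ with $c_j\in\{0,1,2\}$ such that whenever $j<j'$ and $c_j=c_{j'}=2$ there is $j''$ with $j<j''<j'$ and $c_{j''}=0$. The Chung–Graham double shift is $\mathrm{sh}_{CG}^2(n)=\sum_{j\ge1}c_jF_{2j+2}$. For $k\ge2$, $A_k$ is the set of positive integers whose Zeckendorf representation has smallest index $k$. $F_{even}=\bigcup_{k\ge1}A_{2k}$ and $F_{odd}=\bigcup_{k\ge1}A_{2k+1}$. -}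

module Defs where

open import Data.Nat using (ℕ; zero; suc; _+_; _*_; _≤_)
open import Data.Bool using (Bool; true; false)
open import Data.List using (List; []; _∷_; map)
open import Data.Nat.ListAction using (sum)
open import Data.Product using (Σ; _×_)
open import Relation.Binary.PropositionalEquality using (_≡_)

fib : ℕ → ℕ
fib zero = zero
fib (suc zero) = suc zero
fib (suc (suc m)) = fib (suc m) + fib m

data ZIdx : ℕ → List ℕ → Set where
  znil  : ∀ {m} → ZIdx m []
  zcons : ∀ {m i S} → m ≤ i → ZIdx (suc (suc i)) S → ZIdx m (i ∷ S)

ZeckRep : ℕ → List ℕ → Set
ZeckRep n S = ZIdx 2 S × sum (map fib S) ≡ n

shF2 : List ℕ → ℕ
shF2 S = sum (map (λ i → fib (i + 2)) S)

InA : ℕ → ℕ → Set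
InA k n = Σ (List ℕ) (λ S → ZeckRep n (k ∷ S))

Feven : ℕ → Set
Feven n = Σ ℕ (λ k → 1 ≤ k × InA (2 * k) n)

Fodd : ℕ → Set
Fodd n = Σ ℕ (λ k → 1 ≤ k × InA (2 * k + 1) n)

-- Chung–Graham digit lists: the list c = (c_1, c_2, ..., c_L) gives
-- c_j for j = 1..L (c_j = 0 for j > L).  CGOk b c: every digit is in {0,1,2}
-- and between any two digits equal to 2 there is a digit 0; the flag b
-- records whether a 2 has occurred with no 0 after it yet.
data CGOk : Bool → List ℕ → Set where
  cnil  : ∀ {b} → CGOk b []
  czero : ∀ {b cs} → CGOk false cs → CGOk b (0 ∷ cs)
  cone  : ∀ {b cs} → CGOk b cs → CGOk b (1 ∷ cs)
  ctwo  : ∀ {cs} → CGOk true cs → CGOk false (2 ∷ cs)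

cgSum : ℕ → ℕ → List ℕ → ℕ
cgSum s j [] = 0
cgSum s j (c ∷ cs) = c * fib (2 * j + s) + cgSum s (suc j) cs

cgVal : List ℕ → ℕ
cgVal c = cgSum 0 1 c

CGRep : ℕ → List ℕ → Set
CGRep n c = CGOk false c × cgVal c ≡ n

shCG2 : List ℕ → ℕ
shCG2 c = cgSum 2 1 c

-- Strong induction on n proves sh²_CG(n) = sh²_F(n) + (parity of the smallest Zeckendorf
-- index).  Split off the top Zeckendorf index N and the top nonzero Chung–Graham digit
-- d ∈ {1, 2}, of weight F_{a+2}.  The digits below it are worth less than F_{a+2}, and less
-- than F_{a+1} when d = 2 (no two 2s without a 0 between them), which forces N ∈ {a+2, a+3}.
-- Each case reduces to a smaller number: the lower digits against S without its top, the
-- lower digits against S with its top lowered to a+1 (as F_{a+3} = F_{a+2} + F_{a+1}), or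
-- the lower digits with their last digit raised by one (as 2F_{a+2} = F_{a+3} + F_a).  The
-- shifts match because F_{a+3} + F_{a+4} = F_{a+5} and 2F_{a+4} = F_{a+2} + F_{a+5}.
-- Uniqueness of Zeckendorf representations then identifies the parity with F_even/F_odd.

module Submission where

open import Defs
open import Data.Nat using (ℕ; zero; suc; _+_; _*_; _≤_; _<_; _≤′_; ≤′-refl; ≤′-step; z≤n; s≤s)
open import Data.Nat.Properties
open import Data.Nat.Induction using (<-rec)
open import Data.Nat.ListAction using (sum)
open import Data.Nat.ListAction.Properties using (sum-++)
open import Data.List using (List; []; _∷_; map; _++_; _∷ʳ_; length; initLast; InitLast; _∷ʳ′_)
open import Data.List.Properties using (map-++; length-++)
open import Data.Product using (∃; _×_; _,_; proj₁; proj₂)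
open import Data.Sum using (_⊎_; inj₁; inj₂; [_,_]′)
open import Data.Bool using (Bool; true; false)
open import Data.List.Relation.Unary.All using (All; []; _∷_)
open import Relation.Nullary using (contradiction)
open import Function.Bundles using (_⇔_; mk⇔)
open import Relation.Binary.PropositionalEquality
open import Algebra.Properties.CommutativeSemigroup +-commutativeSemigroup using (xy∙z≈y∙xz; xy∙z≈xz∙y; x∙yz≈xz∙y)
open import Data.Nat.Tactic.RingSolver using (solve-∀)

fib-≤-suc : ∀ n → fib n ≤ fib (suc n)
fib-≤-suc zero = z≤n
fib-≤-suc (suc zero) = ≤-refl
fib-≤-suc (suc (suc n)) = m≤m+n _ _

fib-mono-≤ : ∀ {m n} → m ≤ n → fib m ≤ fib n
fib-mono-≤ m≤n = go (≤⇒≤′ m≤n)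
  where
  go : ∀ {m n} → m ≤′ n → fib m ≤ fib n
  go ≤′-refl = ≤-refl
  go {n = suc n} (≤′-step m≤′n) = ≤-trans (go m≤′n) (fib-≤-suc n)

fib-suc-pos : ∀ n → 1 ≤ fib (suc n)
fib-suc-pos n = fib-mono-≤ (s≤s (z≤n {n}))

fib-cancel-< : ∀ {m n} → fib m < fib n → m < n
fib-cancel-< fm<fn = ≰⇒> λ n≤m → <⇒≱ fm<fn (fib-mono-≤ n≤m)

fib-4+ : ∀ a → fib (4 + a) ≡ 2 * fib (2 + a) + fib (1 + a)
fib-4+ a = identity (fib a) (fib (1 + a))
  where
  identity : ∀ p q → ((q + p) + q) + (q + p) ≡ 2 * (q + p) + q
  identity = solve-∀

2*fib-2+ : ∀ a → 2 * fib (2 + a) ≡ fib a + fib (3 + a)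
2*fib-2+ a = identity (fib a) (fib (1 + a))
  where
  identity : ∀ p q → 2 * (q + p) ≡ p + ((q + p) + q)
  identity = solve-∀

zeckVal : List ℕ → ℕ
zeckVal S = sum (map fib S)

sum-map-∷ʳ : ∀ (f : ℕ → ℕ) S N → sum (map f (S ∷ʳ N)) ≡ sum (map f S) + f N
sum-map-∷ʳ f S N = begin
  sum (map f (S ++ N ∷ []))   ≡⟨ cong sum (map-++ f S (N ∷ [])) ⟩
  sum (map f S ++ f N ∷ [])   ≡⟨ sum-++ (map f S) (f N ∷ []) ⟩
  sum (map f S) + (f N + 0)   ≡⟨ cong (sum (map f S) +_) (+-identityʳ (f N)) ⟩
  sum (map f S) + f N         ∎
  where open ≡-Reasoning

zeckVal-∷ʳ : ∀ S N → zeckVal (S ∷ʳ N) ≡ zeckVal S + fib N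
zeckVal-∷ʳ = sum-map-∷ʳ fib

shF2-∷ʳ : ∀ S N → shF2 (S ∷ʳ N) ≡ shF2 S + fib (suc (suc N))
shF2-∷ʳ S N = trans (sum-map-∷ʳ (λ i → fib (i + 2)) S N) (cong (λ i → shF2 S + fib i) (+-comm N 2))

ZIdx-++⁻ˡ : ∀ {m} S {T} → ZIdx m (S ++ T) → ZIdx m S
ZIdx-++⁻ˡ [] _ = znil
ZIdx-++⁻ˡ (i ∷ S) (zcons m≤i z) = zcons m≤i (ZIdx-++⁻ˡ S z)

ZIdx-∷ʳ⁻ : ∀ {m} S {N} → ZIdx m (S ∷ʳ N) → m ≤ N
ZIdx-∷ʳ⁻ [] (zcons m≤N znil) = m≤N
ZIdx-∷ʳ⁻ (i ∷ S) (zcons m≤i z) = ≤-trans m≤i (m+n≤o⇒n≤o 2 (ZIdx-∷ʳ⁻ S z))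

ZIdx-∷ʳ⁺ : ∀ {m S N} → ZIdx m S → zeckVal S < fib (suc N) → m ≤ suc (suc N) →
           ZIdx m (S ∷ʳ suc (suc N))
ZIdx-∷ʳ⁺ znil _ m≤N+2 = zcons m≤N+2 znil
ZIdx-∷ʳ⁺ {S = i ∷ S} (zcons m≤i z) val< _ =
  zcons m≤i (ZIdx-∷ʳ⁺ z (≤-<-trans (m≤n+m _ (fib i)) val<) (s≤s (s≤s i≤N)))
  where i≤N = ≤-pred (fib-cancel-< (≤-<-trans (m≤m+n (fib i) _) val<))

ZIdx-zeckVal≡0 : ∀ {m S} → ZIdx (suc m) S → zeckVal S ≡ 0 → S ≡ []
ZIdx-zeckVal≡0 znil _ = refl
ZIdx-zeckVal≡0 {S = suc i ∷ S} (zcons (s≤s _) _) val≡0 =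
  contradiction (≤-trans (fib-suc-pos i) (≤-trans (m≤m+n _ _) (≤-reflexive val≡0))) λ ()

zeckVal-∷ʳ-< : ∀ {S N} → ZIdx 2 (S ∷ʳ N) → zeckVal (S ∷ʳ N) < fib (suc N)
zeckVal-∷ʳ-< {S} z = ≤-trans (≤-reflexive (+-comm 1 _)) (go S z)
  where
  open ≤-Reasoning
  -- the extra summand fib a is what makes the induction go through
  go : ∀ {a} S {N} → ZIdx (suc a) (S ∷ʳ N) → zeckVal (S ∷ʳ N) + fib a ≤ fib (suc N)
  go {a} [] {suc N} (zcons (s≤s a≤N) znil) = begin
    (fib (suc N) + 0) + fib a  ≤⟨ +-mono-≤ (≤-reflexive (+-identityʳ _)) (fib-mono-≤ a≤N) ⟩
    fib (suc N) + fib N        ∎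
  go {a} (suc i ∷ S) {N} (zcons (s≤s a≤i) z) = begin
    (fib (suc i) + R) + fib a  ≡⟨ +-assoc (fib (suc i)) R (fib a) ⟩
    fib (suc i) + (R + fib a)  ≡⟨ cong (fib (suc i) +_) (+-comm R (fib a)) ⟩
    fib (suc i) + (fib a + R)  ≡⟨ +-assoc (fib (suc i)) (fib a) R ⟨
    (fib (suc i) + fib a) + R  ≤⟨ +-monoˡ-≤ R (+-monoʳ-≤ (fib (suc i)) (fib-mono-≤ a≤i)) ⟩
    fib (suc (suc i)) + R      ≡⟨ +-comm (fib (suc (suc i))) R ⟩
    R + fib (suc (suc i))      ≤⟨ go S z ⟩
    fib (suc N)                ∎
    where R = zeckVal (S ∷ʳ N)

zeck-top-bounds : ∀ {n S N} → ZeckRep n (S ∷ʳ N) → fib N ≤ n × n < fib (suc N)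
zeck-top-bounds {S = S} {N} (z , refl) =
  ≤-trans (m≤n+m (fib N) (zeckVal S)) (≤-reflexive (sym (zeckVal-∷ʳ S N))) , zeckVal-∷ʳ-< z

≤-≤-suc⇒≡⊎≡suc : ∀ {k N} → k ≤ N → N ≤ suc k → N ≡ k ⊎ N ≡ suc k
≤-≤-suc⇒≡⊎≡suc k≤N N≤k+1 with m≤n⇒m<n∨m≡n N≤k+1
... | inj₁ N<k+1 = inj₁ (≤-antisym (≤-pred N<k+1) k≤N)
... | inj₂ N≡k+1 = inj₂ N≡k+1

zeck-top-index : ∀ {n S N k} → ZeckRep n (S ∷ʳ N) → fib k ≤ n → n < fib (suc (suc k)) →
                 N ≡ k ⊎ N ≡ suc k
zeck-top-index rep fk≤n n<fk+2 = ≤-≤-suc⇒≡⊎≡suc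
  (≤-pred (fib-cancel-< (≤-<-trans fk≤n (proj₂ (zeck-top-bounds rep)))))
  (≤-pred (fib-cancel-< (≤-<-trans (proj₁ (zeck-top-bounds rep)) n<fk+2)))

zeck-unique : ∀ n {S T} → ZeckRep n S → ZeckRep n T → S ≡ T
zeck-unique = <-rec _ step
  where
  step : ∀ n → (∀ {m} → m < n → ∀ {S T} → ZeckRep m S → ZeckRep m T → S ≡ T) →
         ∀ {S T} → ZeckRep n S → ZeckRep n T → S ≡ T
  step n rec {S} {T} zS zT with initLast S | initLast T
  ... | [] | _ = sym (ZIdx-zeckVal≡0 (proj₁ zT) (trans (proj₂ zT) (sym (proj₂ zS))))
  ... | _ | [] = ZIdx-zeckVal≡0 (proj₁ zS) (trans (proj₂ zS) (sym (proj₂ zT)))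
  ... | S' ∷ʳ′ N | T' ∷ʳ′ M = cong₂ _∷ʳ_ S'≡T' N≡M
    where
    N≡M : N ≡ M
    N≡M = ≤-antisym
      (≤-pred (fib-cancel-< (≤-<-trans (proj₁ (zeck-top-bounds zS)) (proj₂ (zeck-top-bounds zT)))))
      (≤-pred (fib-cancel-< (≤-<-trans (proj₁ (zeck-top-bounds zT)) (proj₂ (zeck-top-bounds zS)))))
    n≡S' : n ≡ zeckVal S' + fib N
    n≡S' = trans (sym (proj₂ zS)) (zeckVal-∷ʳ S' N)
    S'≡T'-val : zeckVal T' ≡ zeckVal S'
    S'≡T'-val = +-cancelʳ-≡ (fib M) _ _ (begin
      zeckVal T' + fib M  ≡⟨ zeckVal-∷ʳ T' M ⟨
      zeckVal (T' ∷ʳ M)   ≡⟨ trans (proj₂ zT) n≡S' ⟩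
      zeckVal S' + fib N  ≡⟨ cong (λ i → zeckVal S' + fib i) N≡M ⟩
      zeckVal S' + fib M  ∎)
      where open ≡-Reasoning
    S'<n : zeckVal S' < n
    S'<n = subst (zeckVal S' <_) (sym n≡S')
             (m<m+n (zeckVal S') (fib-mono-≤ (ZIdx-∷ʳ⁻ S' (proj₁ zS))))
    S'≡T' : S' ≡ T'
    S'≡T' = rec S'<n (ZIdx-++⁻ˡ S' (proj₁ zS) , refl) (ZIdx-++⁻ˡ T' (proj₁ zT) , S'≡T'-val)

data CGRun : Bool → List ℕ → Bool → Set where
  rnil  : ∀ {b} → CGRun b [] b
  rzero : ∀ {b b' cs} → CGRun false cs b' → CGRun b (0 ∷ cs) b'
  rone  : ∀ {b b' cs} → CGRun b cs b' → CGRun b (1 ∷ cs) b'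
  rtwo  : ∀ {b' cs} → CGRun true cs b' → CGRun false (2 ∷ cs) b'

CGRun⇒CGOk : ∀ {b c b'} → CGRun b c b' → CGOk b c
CGRun⇒CGOk rnil = cnil
CGRun⇒CGOk (rzero r) = czero (CGRun⇒CGOk r)
CGRun⇒CGOk (rone r) = cone (CGRun⇒CGOk r)
CGRun⇒CGOk (rtwo r) = ctwo (CGRun⇒CGOk r)

CGOk-++⁻ : ∀ {b} xs {ys} → CGOk b (xs ++ ys) → ∃ λ b' → CGRun b xs b' × CGOk b' ys
CGOk-++⁻ [] ok = _ , rnil , ok
CGOk-++⁻ (0 ∷ xs) (czero ok) = let b' , r , ok' = CGOk-++⁻ xs ok in b' , rzero r , ok'
CGOk-++⁻ (1 ∷ xs) (cone ok) = let b' , r , ok' = CGOk-++⁻ xs ok in b' , rone r , ok'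
CGOk-++⁻ (2 ∷ xs) (ctwo ok) = let b' , r , ok' = CGOk-++⁻ xs ok in b' , rtwo r , ok'

CGRun-∷ʳ-suc : ∀ {b} xs {y} → CGRun b (xs ∷ʳ y) false → CGOk b (xs ∷ʳ suc y)
CGRun-∷ʳ-suc [] (rzero rnil) = cone cnil
CGRun-∷ʳ-suc [] (rone rnil) = ctwo cnil
CGRun-∷ʳ-suc (0 ∷ xs) (rzero r) = czero (CGRun-∷ʳ-suc xs r)
CGRun-∷ʳ-suc (1 ∷ xs) (rone r) = cone (CGRun-∷ʳ-suc xs r)
CGRun-∷ʳ-suc (2 ∷ xs) (rtwo r) = ctwo (CGRun-∷ʳ-suc xs r)

cgSum-++ : ∀ s j xs ys → cgSum s j (xs ++ ys) ≡ cgSum s j xs + cgSum s (j + length xs) ys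
cgSum-++ s j [] ys = cong (λ k → cgSum s k ys) (sym (+-identityʳ j))
cgSum-++ s j (x ∷ xs) ys = begin
  x * fib (2 * j + s) + cgSum s (suc j) (xs ++ ys)
    ≡⟨ cong (x * fib (2 * j + s) +_) (cgSum-++ s (suc j) xs ys) ⟩
  x * fib (2 * j + s) + (cgSum s (suc j) xs + cgSum s (suc j + length xs) ys)
    ≡⟨ +-assoc (x * fib (2 * j + s)) _ _ ⟨
  cgSum s j (x ∷ xs) + cgSum s (suc j + length xs) ys
    ≡⟨ cong (λ k → cgSum s j (x ∷ xs) + cgSum s k ys) (+-suc j (length xs)) ⟨
  cgSum s j (x ∷ xs) + cgSum s (j + length (x ∷ xs)) ys
    ∎
  where open ≡-Reasoning

cgSum-zeros : ∀ s j {zs} → All (_≡ 0) zs → cgSum s j zs ≡ 0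
cgSum-zeros s j [] = refl
cgSum-zeros s j (refl ∷ zs) = cgSum-zeros s (suc j) zs

cgSum-top : ∀ s c d {zs} → All (_≡ 0) zs →
            cgSum s 1 (c ++ d ∷ zs) ≡ cgSum s 1 c + d * fib (s + (2 + 2 * length c))
cgSum-top s c d {zs} zeros = begin
  cgSum s 1 (c ++ d ∷ zs)                                      ≡⟨ cgSum-++ s 1 c (d ∷ zs) ⟩
  cgSum s 1 c + (d * fib (2 * suc L + s) + cgSum s (2 + L) zs)
    ≡⟨ cong (cgSum s 1 c +_) (cong₂ _+_ weight (cgSum-zeros s _ zeros)) ⟩
  cgSum s 1 c + (d * fib (s + (2 + 2 * L)) + 0)                 ≡⟨ cong (cgSum s 1 c +_) (+-identityʳ _) ⟩
  cgSum s 1 c + d * fib (s + (2 + 2 * L))                       ∎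
  where
  open ≡-Reasoning
  L = length c
  weight : d * fib (2 * suc L + s) ≡ d * fib (s + (2 + 2 * L))
  weight = cong (λ i → d * fib i) (trans (+-comm _ s) (cong (s +_) (*-suc 2 L)))

data LastNonzero : List ℕ → Set where
  all-zero     : ∀ {c} → All (_≡ 0) c → LastNonzero c
  last-nonzero : ∀ c x {zs} → All (_≡ 0) zs → LastNonzero (c ++ suc x ∷ zs)

lastNonzero : ∀ c → LastNonzero c
lastNonzero [] = all-zero []
lastNonzero (x ∷ c) with lastNonzero c
... | last-nonzero c' y zeros = last-nonzero (x ∷ c') y zeros
lastNonzero (zero ∷ c) | all-zero zeros = all-zero (refl ∷ zeros)
lastNonzero (suc x ∷ c) | all-zero zeros = last-nonzero [] x zeros

-- strict bound on the value of an admissible digit string with weights up to F_a;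
-- b records whether the string ends with a pending 2
capacity : Bool → ℕ → ℕ
capacity false a = fib (1 + a)
capacity true  a = fib (2 + a)

capacity-≤ : ∀ b a → capacity b a ≤ fib (2 + a)
capacity-≤ false a = fib-≤-suc (1 + a)
capacity-≤ true  a = ≤-refl

cgSum-digit-bound : ∀ {b b'' b'} d cs i →
  d * fib (2 + 2 * i) + capacity b (2 * i) ≤ capacity b'' (2 + 2 * i) →
  cgSum 0 (suc (suc i)) cs + capacity b'' (2 * suc i) ≤ capacity b' (2 * (suc i + length cs)) →
  cgSum 0 (suc i) (d ∷ cs) + capacity b (2 * i) ≤ capacity b' (2 * (i + length (d ∷ cs)))
cgSum-digit-bound {b} {b''} {b'} d cs i digit rest = begin
  (d * fib (2 * suc i + 0) + R) + capacity b (2 * i)  ≡⟨ cong (λ t → (d * fib t + R) + capacity b (2 * i)) a+2 ⟩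
  (d * fib (2 + 2 * i) + R) + capacity b (2 * i)      ≡⟨ xy∙z≈y∙xz (d * fib (2 + 2 * i)) R (capacity b (2 * i)) ⟩
  R + (d * fib (2 + 2 * i) + capacity b (2 * i))      ≤⟨ +-monoʳ-≤ R digit ⟩
  R + capacity b'' (2 + 2 * i)                        ≡⟨ cong (λ t → R + capacity b'' t) (*-suc 2 i) ⟨
  R + capacity b'' (2 * suc i)                        ≤⟨ rest ⟩
  capacity b' (2 * (suc i + length cs))               ≡⟨ cong (λ j → capacity b' (2 * j)) (+-suc i (length cs)) ⟨
  capacity b' (2 * (i + suc (length cs)))             ∎
  where
  open ≤-Reasoning
  R = cgSum 0 (suc (suc i)) cs
  a+2 : 2 * suc i + 0 ≡ 2 + 2 * i
  a+2 = trans (+-identityʳ _) (*-suc 2 i)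

cgRun-bound : ∀ {b c b'} → CGRun b c b' → ∀ i →
              cgSum 0 (suc i) c + capacity b (2 * i) ≤ capacity b' (2 * (i + length c))
cgRun-bound {b} rnil i = ≤-reflexive (cong (λ j → capacity b (2 * j)) (sym (+-identityʳ i)))
cgRun-bound {b} {0 ∷ cs} {b'} (rzero r) i = cgSum-digit-bound {b} {false} {b'} 0 cs i
  (≤-trans (capacity-≤ b (2 * i)) (fib-≤-suc (2 + 2 * i))) (cgRun-bound r (suc i))
cgRun-bound {false} {1 ∷ cs} {b'} (rone r) i = cgSum-digit-bound {false} {false} {b'} 1 cs i
  (≤-reflexive (cong (_+ fib (1 + 2 * i)) (+-identityʳ _))) (cgRun-bound r (suc i))
cgRun-bound {true} {1 ∷ cs} {b'} (rone r) i = cgSum-digit-bound {true} {true} {b'} 1 cs i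
  (+-monoˡ-≤ (fib (2 + 2 * i)) (≤-trans (≤-reflexive (+-identityʳ _)) (fib-≤-suc (2 + 2 * i))))
  (cgRun-bound r (suc i))
cgRun-bound {false} {2 ∷ cs} {b'} (rtwo r) i = cgSum-digit-bound {false} {true} {b'} 2 cs i
  (≤-reflexive (sym (fib-4+ (2 * i)))) (cgRun-bound r (suc i))

cgVal-<-capacity : ∀ {c b} → CGRun false c b → cgVal c < capacity b (2 * length c)
cgVal-<-capacity r = ≤-trans (≤-reflexive (+-comm 1 _)) (cgRun-bound r 0)

cgSum-∷ʳ-suc : ∀ s c y → cgSum s 1 (c ∷ʳ suc y) ≡ cgSum s 1 (c ∷ʳ y) + fib (s + (2 + 2 * length c))
cgSum-∷ʳ-suc s c y = begin
  cgSum s 1 (c ∷ʳ suc y)          ≡⟨ cgSum-top s c (suc y) [] ⟩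
  cgSum s 1 c + (F + y * F)       ≡⟨ x∙yz≈xz∙y (cgSum s 1 c) F (y * F) ⟩
  (cgSum s 1 c + y * F) + F       ≡⟨ cong (_+ F) (cgSum-top s c y []) ⟨
  cgSum s 1 (c ∷ʳ y) + F          ∎
  where
  open ≡-Reasoning
  F = fib (s + (2 + 2 * length c))

parity : ℕ → ℕ
parity zero = 0
parity (suc zero) = 1
parity (suc (suc n)) = parity n

parity-even : ∀ k → parity (2 * k) ≡ 0
parity-even zero = refl
parity-even (suc k) = trans (cong parity (*-suc 2 k)) (parity-even k)

parity-odd : ∀ k → parity (2 * k + 1) ≡ 1
parity-odd zero = refl
parity-odd (suc k) = trans (cong (λ i → parity (i + 1)) (*-suc 2 k)) (parity-odd k)

parity≡0⇒even : ∀ i → parity i ≡ 0 → ∃ λ k → i ≡ 2 * k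
parity≡0⇒even zero _ = 0 , refl
parity≡0⇒even (suc zero) ()
parity≡0⇒even (suc (suc i)) p with k , refl ← parity≡0⇒even i p = suc k , sym (*-suc 2 k)

lowParity : List ℕ → ℕ
lowParity [] = 0
lowParity (i ∷ _) = parity i

lowParity-∷ʳ-even : ∀ S {N} → parity N ≡ 0 → lowParity (S ∷ʳ N) ≡ lowParity S
lowParity-∷ʳ-even [] even = even
lowParity-∷ʳ-even (_ ∷ _) _ = refl

lowParity-∷ʳ-+2 : ∀ S N → lowParity (S ∷ʳ N) ≡ lowParity (S ∷ʳ (2 + N))
lowParity-∷ʳ-+2 [] N = refl
lowParity-∷ʳ-+2 (_ ∷ _) N = refl

lowParity-∷ʳ-nonempty : ∀ S {N} → 0 < zeckVal S → lowParity (S ∷ʳ N) ≡ lowParity S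
lowParity-∷ʳ-nonempty [] ()
lowParity-∷ʳ-nonempty (_ ∷ _) _ = refl

2*length-∷ʳ : ∀ (c : List ℕ) y → 2 * length (c ∷ʳ y) ≡ 2 + 2 * length c
2*length-∷ʳ c y = trans (cong (2 *_) (trans (length-++ c) (+-comm (length c) 1))) (*-suc 2 (length c))

ShiftRel : ℕ → Set
ShiftRel n = ∀ {S c} → ZeckRep n S → CGRep n c → shCG2 c ≡ shF2 S + lowParity S

-- The inductive step for S = S' ∷ʳ N and c = c' ++ d ∷ zeros, where the top digit d ∈ {1, 2}
-- has weight F_{a+2} with a = 2 * length c'; then N is a + 2 or a + 3.
module _ {n : ℕ} (ih : ∀ {m} → m < n → ShiftRel m) where

  step-digit1-index2+a : ∀ {S' N c' a} → ZeckRep n (S' ∷ʳ N) → CGOk false c' → parity a ≡ 0 →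
      n ≡ cgVal c' + fib (2 + a) → N ≡ 2 + a →
      shCG2 c' + fib (4 + a) ≡ shF2 (S' ∷ʳ N) + lowParity (S' ∷ʳ N)
  step-digit1-index2+a {S'} {_} {c'} {a} (z , val) ok even hn refl = begin
    shCG2 c' + fib (4 + a)                             ≡⟨ cong (_+ fib (4 + a)) rel ⟩
    (shF2 S' + lowParity S') + fib (4 + a)             ≡⟨ xy∙z≈xz∙y (shF2 S') _ _ ⟩
    (shF2 S' + fib (4 + a)) + lowParity S'             ≡⟨ cong₂ _+_ (shF2-∷ʳ S' (2 + a)) (lowParity-∷ʳ-even S' even) ⟨
    shF2 (S' ∷ʳ (2 + a)) + lowParity (S' ∷ʳ (2 + a))   ∎
    where
    open ≡-Reasoning
    S'≡c' : zeckVal S' ≡ cgVal c'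
    S'≡c' = +-cancelʳ-≡ (fib (2 + a)) _ _ (trans (sym (zeckVal-∷ʳ S' (2 + a))) (trans val hn))
    c'<n : cgVal c' < n
    c'<n = subst (cgVal c' <_) (sym hn) (m<m+n _ (fib-suc-pos (1 + a)))
    rel : shCG2 c' ≡ shF2 S' + lowParity S'
    rel = ih c'<n (ZIdx-++⁻ˡ S' z , S'≡c') (ok , refl)

  step-digit1-index3+a : ∀ {S' N c' a} → ZeckRep n (S' ∷ʳ N) → CGOk false c' → cgVal c' < fib (2 + a) →
      n ≡ cgVal c' + fib (2 + a) → N ≡ 3 + a →
      shCG2 c' + fib (4 + a) ≡ shF2 (S' ∷ʳ N) + lowParity (S' ∷ʳ N)
  step-digit1-index3+a {S'} {_} {c'} {a} (z , val) ok c'<F hn refl = begin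
    shCG2 c' + fib (4 + a)                                       ≡⟨ cong (_+ fib (4 + a)) rel ⟩
    (shF2 (S' ∷ʳ (1 + a)) + lowParity (S' ∷ʳ (1 + a))) + fib (4 + a)
      ≡⟨ cong₂ (λ x y → (x + y) + fib (4 + a)) (shF2-∷ʳ S' (1 + a)) (lowParity-∷ʳ-+2 S' (1 + a)) ⟩
    ((shF2 S' + fib (3 + a)) + lowParity (S' ∷ʳ (3 + a))) + fib (4 + a)
      ≡⟨ identity (shF2 S') (fib (3 + a)) (lowParity (S' ∷ʳ (3 + a))) (fib (4 + a)) ⟩
    (shF2 S' + fib (5 + a)) + lowParity (S' ∷ʳ (3 + a))
      ≡⟨ cong (_+ lowParity (S' ∷ʳ (3 + a))) (shF2-∷ʳ S' (3 + a)) ⟨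
    shF2 (S' ∷ʳ (3 + a)) + lowParity (S' ∷ʳ (3 + a))             ∎
    where
    open ≡-Reasoning
    identity : ∀ x y l w → ((x + y) + l) + w ≡ (x + (w + y)) + l
    identity = solve-∀
    -- so S' ∷ʳ (1 + a) represents the value of c'
    c'≡ : cgVal c' ≡ zeckVal S' + fib (1 + a)
    c'≡ = +-cancelʳ-≡ (fib (2 + a)) _ _ (begin
      cgVal c' + fib (2 + a)                 ≡⟨ hn ⟨
      n                                      ≡⟨ trans (sym val) (zeckVal-∷ʳ S' (3 + a)) ⟩
      zeckVal S' + (fib (2 + a) + fib (1 + a)) ≡⟨ x∙yz≈xz∙y (zeckVal S') _ _ ⟩
      zeckVal S' + fib (1 + a) + fib (2 + a)  ∎)
    S'<F : zeckVal S' < fib a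
    S'<F = +-cancelˡ-< (fib (1 + a)) _ _
      (subst (_< fib (1 + a) + fib a) (trans c'≡ (+-comm (zeckVal S') _)) c'<F)
    lowered : ∀ a → zeckVal S' < fib a → ZIdx 2 (S' ∷ʳ (1 + a))
    lowered zero ()
    lowered (suc a) S'<F = ZIdx-∷ʳ⁺ (ZIdx-++⁻ˡ S' z) S'<F (s≤s (s≤s z≤n))
    c'<n : cgVal c' < n
    c'<n = subst (cgVal c' <_) (sym hn) (m<m+n _ (fib-suc-pos (1 + a)))
    rel : shCG2 c' ≡ shF2 (S' ∷ʳ (1 + a)) + lowParity (S' ∷ʳ (1 + a))
    rel = ih c'<n (lowered a S'<F , trans (zeckVal-∷ʳ S' (1 + a)) (sym c'≡)) (ok , refl)

  step-digit2-index3+a : ∀ {S' N c' a} → ZeckRep n (S' ∷ʳ N) → CGRun false c' false → a ≡ 2 * length c' →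
      n ≡ cgVal c' + 2 * fib (2 + a) → N ≡ 3 + a →
      shCG2 c' + 2 * fib (4 + a) ≡ shF2 (S' ∷ʳ N) + lowParity (S' ∷ʳ N)
  step-digit2-index3+a {S'} {_} {c'} {a} (z , val) run a≡ hn refl = go (initLast c') run a≡ S'≡
    where
    open ≡-Reasoning
    -- two copies of F_{a+2} are F_{a+3} plus the weight F_a of the digit below
    S'≡ : zeckVal S' ≡ cgVal c' + fib a
    S'≡ = +-cancelʳ-≡ (fib (3 + a)) _ _ (begin
      zeckVal S' + fib (3 + a)            ≡⟨ zeckVal-∷ʳ S' (3 + a) ⟨
      zeckVal (S' ∷ʳ (3 + a))             ≡⟨ trans val hn ⟩
      cgVal c' + 2 * fib (2 + a)          ≡⟨ cong (cgVal c' +_) (2*fib-2+ a) ⟩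
      cgVal c' + (fib a + fib (3 + a))    ≡⟨ +-assoc (cgVal c') _ _ ⟨
      cgVal c' + fib a + fib (3 + a)      ∎)
    S'<n : zeckVal S' < n
    S'<n = subst (zeckVal S' <_) (trans (sym (zeckVal-∷ʳ S' (3 + a))) val)
             (m<m+n _ (fib-suc-pos (2 + a)))
    go : ∀ {c'} → InitLast c' → CGRun false c' false → a ≡ 2 * length c' → zeckVal S' ≡ cgVal c' + fib a →
         shCG2 c' + 2 * fib (4 + a) ≡ shF2 (S' ∷ʳ (3 + a)) + lowParity (S' ∷ʳ (3 + a))
    go [] _ refl S'≡0 with refl ← ZIdx-zeckVal≡0 (ZIdx-++⁻ˡ S' z) S'≡0 = refl
    go (c0 ∷ʳ′ y) run a≡ S'≡ with refl ← trans a≡ (2*length-∷ʳ c0 y) = begin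
      shCG2 (c0 ∷ʳ y) + 2 * fib (4 + a)                ≡⟨ cong (shCG2 (c0 ∷ʳ y) +_) (2*fib-2+ (2 + a)) ⟩
      shCG2 (c0 ∷ʳ y) + (fib (2 + a) + fib (5 + a))     ≡⟨ +-assoc (shCG2 (c0 ∷ʳ y)) _ _ ⟨
      (shCG2 (c0 ∷ʳ y) + fib (2 + a)) + fib (5 + a)     ≡⟨ cong (_+ fib (5 + a)) (cgSum-∷ʳ-suc 2 c0 y) ⟨
      shCG2 c'' + fib (5 + a)                           ≡⟨ cong (_+ fib (5 + a)) rel ⟩
      (shF2 S' + lowParity S') + fib (5 + a)            ≡⟨ xy∙z≈xz∙y (shF2 S') _ _ ⟩
      (shF2 S' + fib (5 + a)) + lowParity S'
        ≡⟨ cong₂ _+_ (shF2-∷ʳ S' (3 + a)) (lowParity-∷ʳ-nonempty S' S'-pos) ⟨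
      shF2 (S' ∷ʳ (3 + a)) + lowParity (S' ∷ʳ (3 + a))  ∎
      where
      c'' = c0 ∷ʳ suc y
      S'-pos : 0 < zeckVal S'
      S'-pos = subst (0 <_) (sym S'≡) (≤-trans (fib-suc-pos (1 + 2 * length c0)) (m≤n+m _ (cgVal (c0 ∷ʳ y))))
      rel : shCG2 c'' ≡ shF2 S' + lowParity S'
      rel = ih S'<n (ZIdx-++⁻ˡ S' z , refl) (CGRun-∷ʳ-suc c0 run , trans (cgSum-∷ʳ-suc 0 c0 y) (sym S'≡))

  step-digit1 : ∀ {S' N c' b} → ZeckRep n (S' ∷ʳ N) → CGRun false c' b →
      n ≡ cgVal c' + fib (2 + 2 * length c') →
      shCG2 c' + fib (4 + 2 * length c') ≡ shF2 (S' ∷ʳ N) + lowParity (S' ∷ʳ N)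
  step-digit1 {c' = c'} {b} zS run hn =
    [ step-digit1-index2+a {a = a} zS ok (parity-even (length c')) hn
    , step-digit1-index3+a {a = a} zS ok c'<F hn
    ]′
      (zeck-top-index zS (≤-trans (m≤n+m F (cgVal c')) (≤-reflexive (sym hn))) n<F₄)
    where
    a = 2 * length c'
    F = fib (2 + a)
    ok = CGRun⇒CGOk run
    c'<F : cgVal c' < F
    c'<F = <-≤-trans (cgVal-<-capacity run) (capacity-≤ b _)
    n<F₄ : n < fib (4 + 2 * length c')
    n<F₄ = subst (_< fib (4 + 2 * length c')) (sym hn)
      (<-≤-trans (+-monoˡ-< F c'<F) (+-monoˡ-≤ F (fib-≤-suc (2 + 2 * length c'))))

  step-digit2 : ∀ {S' N c'} → ZeckRep n (S' ∷ʳ N) → CGRun false c' false →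
      n ≡ cgVal c' + 2 * fib (2 + 2 * length c') →
      shCG2 c' + 2 * fib (4 + 2 * length c') ≡ shF2 (S' ∷ʳ N) + lowParity (S' ∷ʳ N)
  step-digit2 {c' = c'} zS run hn =
    [ (λ { refl → contradiction F₃≤n (<⇒≱ (proj₂ (zeck-top-bounds zS))) })
    , step-digit2-index3+a {a = a} zS run refl hn
    ]′
      (zeck-top-index zS (≤-trans (m≤m+n F _) 2F≤n) n<F₄)
    where
    a = 2 * length c'
    F = fib (2 + a)
    2F≤n : 2 * F ≤ n
    2F≤n = ≤-trans (m≤n+m (2 * F) (cgVal c')) (≤-reflexive (sym hn))
    F₃≤n : fib (3 + a) ≤ n
    F₃≤n = ≤-trans (m≤n+m _ (fib a)) (≤-trans (≤-reflexive (sym (2*fib-2+ a))) 2F≤n)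
    n<F₄ : n < fib (4 + a)
    n<F₄ = subst₂ _<_ (sym hn) (trans (+-comm _ (2 * F)) (sym (fib-4+ a)))
      (+-monoˡ-< (2 * F) (cgVal-<-capacity run))

shiftRel : ∀ n → ShiftRel n
shiftRel = <-rec ShiftRel step
  where
  step : ∀ n → (∀ {m} → m < n → ShiftRel m) → ShiftRel n
  step n ih {S} {c} zS (ok , val) with lastNonzero c | initLast S
  ... | all-zero zeros | _
      with refl ← ZIdx-zeckVal≡0 (proj₁ zS) (trans (proj₂ zS) (trans (sym val) (cgSum-zeros 0 1 zeros)))
      = cgSum-zeros 2 1 zeros
  ... | last-nonzero c' x zeros | [] =
      contradiction (sym (trans val (sym (proj₂ zS)))) (<⇒≢ (≤-trans (fib-suc-pos (1 + 2 * length c')) top≤val))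
    where
    top≤val : fib (2 + 2 * length c') ≤ cgVal (c' ++ suc x ∷ _)
    top≤val = ≤-trans (m≤m+n _ _)
      (≤-trans (m≤n+m _ (cgVal c')) (≤-reflexive (sym (cgSum-top 0 c' (suc x) zeros))))
  ... | last-nonzero c' x zeros | S' ∷ʳ′ N with CGOk-++⁻ c' ok
  ...   | _ , run , cone _ = begin
      shCG2 (c' ++ 1 ∷ _)                        ≡⟨ cgSum-top 2 c' 1 zeros ⟩
      shCG2 c' + 1 * fib (4 + 2 * length c')     ≡⟨ cong (shCG2 c' +_) (*-identityˡ _) ⟩
      shCG2 c' + fib (4 + 2 * length c')         ≡⟨ step-digit1 ih zS run hn ⟩
      shF2 (S' ∷ʳ N) + lowParity (S' ∷ʳ N)        ∎
    where
    open ≡-Reasoning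
    hn = trans (sym val) (trans (cgSum-top 0 c' 1 zeros) (cong (cgVal c' +_) (*-identityˡ _)))
  ...   | _ , run , ctwo _ =
      trans (cgSum-top 2 c' 2 zeros) (step-digit2 ih zS run (trans (sym val) (cgSum-top 0 c' 2 zeros)))

lowParity≡0⇒Feven : ∀ {n S} → 1 ≤ n → ZeckRep n S → lowParity S ≡ 0 → Feven n
lowParity≡0⇒Feven () (znil , refl) _
lowParity≡0⇒Feven {S = i ∷ T} _ (zcons 2≤i zT , val) even with parity≡0⇒even i even
... | zero , refl = contradiction 2≤i λ ()
... | suc k , refl = suc k , s≤s z≤n , T , zcons 2≤i zT , val

lemma3 : (n : ℕ) → 1 ≤ n → (S c : List ℕ) → ZeckRep n S → CGRep n c →
    ((shCG2 c ≡ shF2 S) ⇔ Feven n)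
    × (Feven n → shCG2 c ≡ shF2 S)
    × (Fodd n → shCG2 c ≡ shF2 S + 1)
lemma3 n 1≤n S c zS cS = mk⇔ even-if-equal equal-if-even , equal-if-even , plus-one-if-odd
  where
  rel : shCG2 c ≡ shF2 S + lowParity S
  rel = shiftRel n zS cS
  equal-if-even : Feven n → shCG2 c ≡ shF2 S
  equal-if-even (k , _ , T , zT) with refl ← zeck-unique n zS zT =
    trans rel (trans (cong (shF2 S +_) (parity-even k)) (+-identityʳ _))
  plus-one-if-odd : Fodd n → shCG2 c ≡ shF2 S + 1
  plus-one-if-odd (k , _ , T , zT) with refl ← zeck-unique n zS zT =
    trans rel (cong (shF2 S +_) (parity-odd k))
  even-if-equal : shCG2 c ≡ shF2 S → Feven n
  even-if-equal eq = lowParity≡0⇒Feven 1≤n zS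
    (+-cancelˡ-≡ (shF2 S) _ _ (trans (sym rel) (trans eq (sym (+-identityʳ _)))))
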